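{- Let $p$ be an odd prime, $\mathbf{C}^{(p)}=(c_i)_{i\ge0}$ the $p$-Cantor sequence and $\mathbf{S}(p)=(s^{(p)}_i)_{i\ge0}$ the $p$-Singer sequence, and set $\Theta_p(t)=\sum_{i\ge0}c_it^{ -i}$ and $\Xi_p(t)=\sum_{i\ge0}s^{(p)}_it^{ -i}$ in $\mathbb{F}_p((t^{ -1}))$. Then $\Theta_p(t)\cdot\Xi_p(t)=1$.
   Context: $\mathbb{F}_p((t^{ -1}))$ is the field of formal Laurent series in $t^{ -1}$ over $\mathbb{F}_p$. $p_2=(p-1)/2$. For real $a,b$, $\binom{a}{b}=\frac{a!}{b!(a-b)!}$ if $a,b$ are nonnegative integers with $a\ge b$, and $0$ otherwise. $p$-Cantor: $\phi_p$ sends each letter $n\in\{0,\dots,p-1\}$ to the length-$p$ word with $i$-th letter $n\binom{p_2}{i/2}\bmod p$; $\mathbf{C}^{(p)}=\lim_k\phi_p^k(1)$. $p$-Singer: $\varphi_p$ sends $n$ to the length-$p$ word with $i$-th letter $n\binom{p_2}{i}\bmod p$; $\tau_p$ sends $n$ to the length-$2p$ word with $i$-th letter $n\binom{p_2+1}{i/2}\bmod p$ ($0\le i\le 2p-1$); all maps extended to words by concatenation; $\mathbf{S}(p)=\tau_p(\lim_k\varphi_p^k(1))$. -}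

module Defs where

open import Data.Nat using (ℕ; zero; suc; _+_; _*_; _∸_; _^_; NonZero)
open import Data.Nat.DivMod using (_/_; _%_)
open import Data.Nat.Combinatorics using (_C_)
open import Data.Bool using (if_then_else_)
open import Data.Nat using (_≡ᵇ_)
open import Data.List using (List; []; _∷_; concatMap; upTo; map)
open import Data.Nat.ListAction using (sum)
open import Function using (_∘_)

-- Generalised binomial from the paper: binom a b = a!/(b!(a-b)!) when a,b are
-- nonnegative integers with a ≥ b, and 0 otherwise (stdlib _C_ gives 0 if b > a).
-- binomHalf a i = binom a (i/2) with i/2 a real number: 0 unless i is even.
binomHalf : ℕ → ℕ → ℕ
binomHalf a i = if (i % 2) ≡ᵇ 0 then a C (i / 2) else 0

word : ℕ → (ℕ → ℕ) → List ℕ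
word m f = map f (upTo m)

ext : (ℕ → List ℕ) → List ℕ → List ℕ
ext σ = concatMap σ

iter : ℕ → (List ℕ → List ℕ) → List ℕ → List ℕ
iter zero    F w = w
iter (suc k) F w = F (iter k F w)

-- i-th letter of a word (0 if out of range; only used in range)
nth : List ℕ → ℕ → ℕ
nth []      _       = 0
nth (x ∷ _) zero    = x
nth (_ ∷ w) (suc i) = nth w i

module _ (p : ℕ) .{{_ : NonZero p}} where

  p₂ : ℕ
  p₂ = (p ∸ 1) / 2

  φCantor : ℕ → List ℕ
  φCantor n = word p (λ i → (n * binomHalf p₂ i) % p)

  φSinger : ℕ → List ℕ
  φSinger n = word p (λ i → (n * (p₂ C i)) % p)

  τ : ℕ → List ℕ
  τ n = word (2 * p) (λ i → (n * binomHalf (suc p₂) i) % p)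

  -- C^(p) = lim_k φ_p^k(1): the i-th term is the i-th letter of φ_p^(i+1)(1)
  -- (φ_p^k(1) has length p^k > i and is a prefix of all later iterates).
  cantor : ℕ → ℕ
  cantor i = nth (iter (suc i) (ext φCantor) (1 ∷ [])) i

  -- S(p) = τ_p(lim_k ϕ_p^k(1)): the i-th term is the i-th letter of τ_p(ϕ_p^(i+1)(1)).
  singer : ℕ → ℕ
  singer i = nth (ext τ (iter (suc i) (ext φSinger) (1 ∷ []))) i

  -- n-th coefficient (in t^{-n}) of the product Θ_p · Ξ_p in F_p((t^{-1})),
  -- represented as a residue in {0,…,p-1}
  prodCoeff : ℕ → ℕ
  prodCoeff n = sum (map (λ i → cantor i * singer (n ∸ i)) (upTo (suc n))) % p

oneCoeff : ℕ → ℕ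
oneCoeff zero    = 1
oneCoeff (suc _) = 0

-- Write x = t⁻¹ and read every series as its coefficient sequence, compared modulo p; A(xᵏ) is
-- the dilation of A.  Since φ_p multiplies the letters of a block by the coefficients of
-- P = Σ binom(p₂,i) x²ⁱ, the Cantor series satisfies C ≡ P · C(xᵖ).  In the same way the fixed
-- point U of ϕ_p satisfies U ≡ (1+x)^p₂ · U(xᵖ), so U(x²) obeys the functional equation of C and,
-- having the same constant term, equals C.  As τ_p multiplies the letters of U by the coefficients
-- of (1+x²)P, the Singer series is S ≡ (1+x²)P · U(x²ᵖ) = (1+x²)P · C(xᵖ).  Hence
-- C·S ≡ (1+x²)P² · C(xᵖ)², and (1+x²)P² = (1+x²)ᵖ ≡ 1 + x²ᵖ by Frobenius, so F = (1+x²)C²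
-- satisfies F ≡ F(xᵖ).  An equation A ≡ B · A(xᵏ) with k > 1 determines A from A(0); thus F ≡ 1
-- and C·S ≡ F(xᵖ) ≡ 1.

module Submission where

open import Algebra.Bundles using (CommutativeSemigroup)
open import Data.Bool using (true; false; if_then_else_)
open import Data.Empty using (⊥-elim)
open import Data.List using (List; []; _∷_; _++_; length; map; upTo; applyUpTo)
open import Data.List.Properties using (map-applyUpTo; length-applyUpTo; length-map; length-++)
open import Data.Nat
open import Data.Nat.Combinatorics
  using (_C_; nCk≡n!/k![n-k]!; k![n∸k]!∣n!; k>n⇒nCk≡0; nCn≡1; nCk+nC[k+1]≡[n+1]C[k+1])
open import Data.Nat.Divisibility using (_∣_; m∣m*n; n∣m*n; ∣⇒≤; n∣m⇒m%n≡0; m%n≡0⇒n∣m; ∣1⇒≡1)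
open import Data.Nat.DivMod
open import Data.Nat.Induction using (<-rec)
open import Data.Nat.ListAction using (sum)
open import Data.Nat.Primality using (Prime; euclidsLemma; prime⇒nonTrivial; prime⇒irreducible)
open import Data.Nat.Properties
open import Data.Product using (∃; _,_)
open import Data.Sum using (_⊎_; inj₁; inj₂; [_,_]′)
open import Function using (_∘_; id)
open import Level using (0ℓ)
open import Relation.Binary.Bundles using (Setoid)
open import Relation.Binary.PropositionalEquality
import Relation.Binary.Reasoning.Setoid as SetoidReasoning
open import Relation.Nullary using (¬_; yes; no)
open import Defs

open import Algebra.Properties.CommutativeSemigroup +-commutativeSemigroup
  using () renaming (interchange to +-interchange)

-- Power series as coefficient sequences

Series : Set
Series = ℕ → ℕ

tail : Series → Series
tail a i = a (suc i)

infixl 6 _+ₛ_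
infixl 7 _·ₛ_ _⋆_

_+ₛ_ : Series → Series → Series
(a +ₛ b) i = a i + b i

_·ₛ_ : ℕ → Series → Series
(c ·ₛ a) i = c * a i

_⋆_ : Series → Series → Series
(a ⋆ b) zero    = a 0 * b 0
(a ⋆ b) (suc n) = a 0 * b (suc n) + (tail a ⋆ b) n

⋆-cong : ∀ {a a′ b b′} → a ≗ a′ → b ≗ b′ → a ⋆ b ≗ a′ ⋆ b′
⋆-cong ea eb zero    = cong₂ _*_ (ea 0) (eb 0)
⋆-cong ea eb (suc n) = cong₂ _+_ (cong₂ _*_ (ea 0) (eb (suc n))) (⋆-cong (λ i → ea (suc i)) eb n)

⋆-congˡ : ∀ a {b b′} → b ≗ b′ → a ⋆ b ≗ a ⋆ b′
⋆-congˡ a = ⋆-cong {a} (λ _ → refl)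

⋆-congʳ : ∀ b {a a′} → a ≗ a′ → a ⋆ b ≗ a′ ⋆ b
⋆-congʳ b ea = ⋆-cong ea (λ _ → refl)

⋆-distribʳ-+ : ∀ a a′ b → (a +ₛ a′) ⋆ b ≗ a ⋆ b +ₛ a′ ⋆ b
⋆-distribʳ-+ a a′ b zero    = *-distribʳ-+ (b 0) (a 0) (a′ 0)
⋆-distribʳ-+ a a′ b (suc n) = trans
  (cong₂ _+_ (*-distribʳ-+ (b (suc n)) (a 0) (a′ 0)) (⋆-distribʳ-+ (tail a) (tail a′) b n))
  (+-interchange (a 0 * b (suc n)) (a′ 0 * b (suc n)) _ _)

⋆-scaleˡ : ∀ c a b → (c ·ₛ a) ⋆ b ≗ c ·ₛ (a ⋆ b)
⋆-scaleˡ c a b zero    = *-assoc c (a 0) (b 0)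
⋆-scaleˡ c a b (suc n) = trans
  (cong₂ _+_ (*-assoc c (a 0) (b (suc n))) (⋆-scaleˡ c (tail a) b n))
  (sym (*-distribˡ-+ c (a 0 * b (suc n)) _))

⋆-zeroˡ : ∀ b → (λ _ → 0) ⋆ b ≗ λ _ → 0
⋆-zeroˡ b zero    = refl
⋆-zeroˡ b (suc n) = ⋆-zeroˡ b n

⋆-identityˡ : ∀ b → oneCoeff ⋆ b ≗ b
⋆-identityˡ b zero    = +-identityʳ (b 0)
⋆-identityˡ b (suc n) = trans (cong₂ _+_ (+-identityʳ (b (suc n))) (⋆-zeroˡ b n)) (+-identityʳ (b (suc n)))

⋆-suc : ∀ a b n → (a ⋆ b) (suc n) ≡ (a ⋆ tail b) n + a (suc n) * b 0
⋆-suc a b zero    = refl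
⋆-suc a b (suc n) = trans
  (cong (a 0 * b (suc (suc n)) +_) (⋆-suc (tail a) b n))
  (sym (+-assoc (a 0 * b (suc (suc n))) _ _))

⋆-comm : ∀ a b → a ⋆ b ≗ b ⋆ a
⋆-comm a b zero    = *-comm (a 0) (b 0)
⋆-comm a b (suc n) = begin
  a 0 * b (suc n) + (tail a ⋆ b) n   ≡⟨ cong (a 0 * b (suc n) +_) (⋆-comm (tail a) b n) ⟩
  a 0 * b (suc n) + (b ⋆ tail a) n   ≡⟨ +-comm (a 0 * b (suc n)) _ ⟩
  (b ⋆ tail a) n + a 0 * b (suc n)   ≡⟨ cong ((b ⋆ tail a) n +_) (*-comm (a 0) (b (suc n))) ⟩
  (b ⋆ tail a) n + b (suc n) * a 0   ≡⟨ ⋆-suc b a n ⟨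
  (b ⋆ a) (suc n)                    ∎
  where open ≡-Reasoning

⋆-assoc : ∀ a b c → (a ⋆ b) ⋆ c ≗ a ⋆ (b ⋆ c)
⋆-assoc a b c zero    = *-assoc (a 0) (b 0) (c 0)
⋆-assoc a b c (suc n) = begin
  x + ((a 0 ·ₛ tail b +ₛ tail a ⋆ b) ⋆ c) n
    ≡⟨ cong (x +_) (⋆-distribʳ-+ (a 0 ·ₛ tail b) (tail a ⋆ b) c n) ⟩
  x + (((a 0 ·ₛ tail b) ⋆ c) n + ((tail a ⋆ b) ⋆ c) n)
    ≡⟨ cong₂ (λ u v → x + (u + v)) (⋆-scaleˡ (a 0) (tail b) c n) (⋆-assoc (tail a) b c n) ⟩
  x + (a 0 * (tail b ⋆ c) n + (tail a ⋆ (b ⋆ c)) n)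
    ≡⟨ +-assoc x _ _ ⟨
  x + a 0 * (tail b ⋆ c) n + (tail a ⋆ (b ⋆ c)) n
    ≡⟨ cong (λ u → u + a 0 * (tail b ⋆ c) n + (tail a ⋆ (b ⋆ c)) n) (*-assoc (a 0) (b 0) (c (suc n))) ⟩
  a 0 * (b 0 * c (suc n)) + a 0 * (tail b ⋆ c) n + (tail a ⋆ (b ⋆ c)) n
    ≡⟨ cong (_+ (tail a ⋆ (b ⋆ c)) n) (*-distribˡ-+ (a 0) _ _) ⟨
  a 0 * (b ⋆ c) (suc n) + (tail a ⋆ (b ⋆ c)) n
    ∎
  where
  open ≡-Reasoning
  x = a 0 * b 0 * c (suc n)

⋆≡sum : ∀ a b n → (a ⋆ b) n ≡ sum (map (λ i → a i * b (n ∸ i)) (upTo (suc n)))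
⋆≡sum a b n = trans (⋆≡sum-applyUpTo a n) (cong sum (sym (map-applyUpTo id (λ i → a i * b (n ∸ i)) (suc n))))
  where
  ⋆≡sum-applyUpTo : ∀ a n → (a ⋆ b) n ≡ sum (applyUpTo (λ i → a i * b (n ∸ i)) (suc n))
  ⋆≡sum-applyUpTo a zero    = sym (+-identityʳ (a 0 * b 0))
  ⋆≡sum-applyUpTo a (suc n) = cong (a 0 * b (suc n) +_) (⋆≡sum-applyUpTo (tail a) n)

⋆-commutativeSemigroup : CommutativeSemigroup 0ℓ 0ℓ
⋆-commutativeSemigroup = record
  { Carrier = Series
  ; _≈_     = _≗_
  ; _∙_     = _⋆_
  ; isCommutativeSemigroup = record
    { isSemigroup = record
      { isMagma = record
        { isEquivalence = Setoid.isEquivalence (ℕ →-setoid ℕ)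
        ; ∙-cong        = ⋆-cong
        }
      ; assoc = ⋆-assoc
      }
    ; comm = ⋆-comm
    }
  }

open import Algebra.Properties.CommutativeSemigroup ⋆-commutativeSemigroup
  using () renaming (interchange to ⋆-interchange; x∙yz≈y∙xz to ⋆-leftComm)

-- Shifts and dilations

shift : ℕ → Series → Series
shift zero    a n       = a n
shift (suc k) a zero    = 0
shift (suc k) a (suc n) = shift k a n

shift-< : ∀ k a {n} → n < k → shift k a n ≡ 0
shift-< (suc k) a {zero}  _         = refl
shift-< (suc k) a {suc n} (s≤s n<k) = shift-< k a n<k

shift-+ : ∀ k a j → shift k a (k + j) ≡ a j
shift-+ zero    a j = refl
shift-+ (suc k) a j = shift-+ k a j

⋆-shiftˡ : ∀ k a b → shift k a ⋆ b ≗ shift k (a ⋆ b)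
⋆-shiftˡ zero    a b n       = refl
⋆-shiftˡ (suc k) a b zero    = refl
⋆-shiftˡ (suc k) a b (suc n) = ⋆-shiftˡ k a b n

shift-cong : ∀ k {a b} → a ≗ b → shift k a ≗ shift k b
shift-cong zero    a≗b n       = a≗b n
shift-cong (suc k) a≗b zero    = refl
shift-cong (suc k) a≗b (suc n) = shift-cong k a≗b n

<⊎≡+ : ∀ k n → n < k ⊎ ∃ λ j → n ≡ k + j
<⊎≡+ zero    n    = inj₂ (n , refl)
<⊎≡+ (suc k) zero = inj₁ z<s
<⊎≡+ (suc k) (suc n) with <⊎≡+ k n
... | inj₁ n<k       = inj₁ (s≤s n<k)
... | inj₂ (j , n≡k+j) = inj₂ (j , cong suc n≡k+j)

0%n≡0 : ∀ n .{{_ : NonZero n}} → 0 % n ≡ 0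
0%n≡0 (suc n) = refl

dilate : (k : ℕ) .{{_ : NonZero k}} → Series → Series
dilate k a n = if n % k ≡ᵇ 0 then a (n / k) else 0

module _ (k : ℕ) .{{_ : NonZero k}} where

  private
    [k+j]%k≡j%k : ∀ j → (k + j) % k ≡ j % k
    [k+j]%k≡j%k j = trans (cong (_% k) (+-comm k j)) ([m+n]%n≡m%n j k)

    [k+j]/k≡1+j/k : ∀ j → (k + j) / k ≡ suc (j / k)
    [k+j]/k≡1+j/k j = trans (m/n≡1+[m∸n]/n (m≤m+n k j)) (cong (λ t → suc (t / k)) (m+n∸m≡n k j))

    oneCoeff[k+j]≡0 : ∀ j → oneCoeff (k + j) ≡ 0
    oneCoeff[k+j]≡0 j = cong (λ m → oneCoeff (m + j)) (sym (suc-pred k))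

    j<k+j : ∀ j → j < k + j
    j<k+j j = m<n+m j (>-nonZero⁻¹ k)

  dilate-∣ : ∀ a n → n % k ≡ 0 → dilate k a n ≡ a (n / k)
  dilate-∣ a n n%k≡0 rewrite n%k≡0 = refl

  dilate-∤ : ∀ a n → n % k ≢ 0 → dilate k a n ≡ 0
  dilate-∤ a n n%k≢0 with n % k | n%k≢0
  ... | zero  | ≢0 = ⊥-elim (≢0 refl)
  ... | suc _ | _  = refl

  dilate-cong : ∀ {a b} → a ≗ b → dilate k a ≗ dilate k b
  dilate-cong a≗b n with n % k ≡ᵇ 0
  ... | true  = a≗b (n / k)
  ... | false = refl

  dilate-+ₛ : ∀ a b → dilate k (a +ₛ b) ≗ dilate k a +ₛ dilate k b
  dilate-+ₛ a b n with n % k ≡ᵇ 0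
  ... | true  = refl
  ... | false = refl

  dilate-·ₛ : ∀ c a → dilate k (c ·ₛ a) ≗ c ·ₛ dilate k a
  dilate-·ₛ c a n with n % k ≡ᵇ 0
  ... | true  = refl
  ... | false = sym (*-zeroʳ c)

  dilate-degree : ∀ {d a} → (∀ i → d < i → a i ≡ 0) → ∀ i → d * k < i → dilate k a i ≡ 0
  dilate-degree {d} {a} a-deg i dk<i with i % k ≟ 0
  ... | no  i%k≢0 = dilate-∤ a i i%k≢0
  ... | yes i%k≡0 = trans (dilate-∣ a i i%k≡0) (a-deg (i / k) (*-cancelʳ-< k d (i / k) dk<[i/k]k))
    where
    dk<[i/k]k : d * k < i / k * k
    dk<[i/k]k = subst (d * k <_) (trans (m≡m%n+[m/n]*n i k) (cong (_+ i / k * k) i%k≡0)) dk<i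

  dilate-< : ∀ a {n} → n < k → dilate k a n ≡ a 0 * oneCoeff n
  dilate-< a {zero}  _   = begin
    dilate k a 0    ≡⟨ dilate-∣ a 0 (0%n≡0 k) ⟩
    a (0 / k)       ≡⟨ cong a (0/n≡0 k) ⟩
    a 0             ≡⟨ *-identityʳ (a 0) ⟨
    a 0 * 1         ∎
    where open ≡-Reasoning
  dilate-< a {suc n} n<k = begin
    dilate k a (suc n) ≡⟨ dilate-∤ a (suc n) (λ e → 1+n≢0 (trans (sym (m<n⇒m%n≡m n<k)) e)) ⟩
    0                  ≡⟨ *-zeroʳ (a 0) ⟨
    a 0 * 0            ∎
    where open ≡-Reasoning

  dilate-+ : ∀ a j → dilate k a (k + j) ≡ dilate k (tail a) j
  dilate-+ a j rewrite [k+j]%k≡j%k j | [k+j]/k≡1+j/k j = refl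

  dilate-unfold : ∀ a → dilate k a ≗ a 0 ·ₛ oneCoeff +ₛ shift k (dilate k (tail a))
  dilate-unfold a n with <⊎≡+ k n
  ... | inj₁ n<k = begin
    dilate k a n                              ≡⟨ dilate-< a n<k ⟩
    a 0 * oneCoeff n                          ≡⟨ +-identityʳ _ ⟨
    a 0 * oneCoeff n + 0                      ≡⟨ cong (a 0 * oneCoeff n +_) (shift-< k _ n<k) ⟨
    a 0 * oneCoeff n + shift k (dilate k (tail a)) n ∎
    where open ≡-Reasoning
  ... | inj₂ (j , refl) = begin
    dilate k a (k + j)                        ≡⟨ dilate-+ a j ⟩
    dilate k (tail a) j                       ≡⟨ shift-+ k _ j ⟨
    shift k (dilate k (tail a)) (k + j)       ≡⟨ cong (_+ shift k (dilate k (tail a)) (k + j)) a₀*0≡0 ⟨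
    a 0 * oneCoeff (k + j) + shift k (dilate k (tail a)) (k + j) ∎
    where
    open ≡-Reasoning
    a₀*0≡0 : a 0 * oneCoeff (k + j) ≡ 0
    a₀*0≡0 = trans (cong (a 0 *_) (oneCoeff[k+j]≡0 j)) (*-zeroʳ (a 0))

  ⋆-dilateˡ : ∀ a b → dilate k a ⋆ b ≗ a 0 ·ₛ b +ₛ shift k (dilate k (tail a) ⋆ b)
  ⋆-dilateˡ a b n = begin
    (dilate k a ⋆ b) n
      ≡⟨ ⋆-congʳ b (dilate-unfold a) n ⟩
    ((a 0 ·ₛ oneCoeff +ₛ shift k (dilate k (tail a))) ⋆ b) n
      ≡⟨ ⋆-distribʳ-+ (a 0 ·ₛ oneCoeff) _ b n ⟩
    ((a 0 ·ₛ oneCoeff) ⋆ b) n + (shift k (dilate k (tail a)) ⋆ b) n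
      ≡⟨ cong₂ _+_ (trans (⋆-scaleˡ (a 0) oneCoeff b n) (cong (a 0 *_) (⋆-identityˡ b n)))
                   (⋆-shiftˡ k _ b n) ⟩
    a 0 * b n + shift k (dilate k (tail a) ⋆ b) n
      ∎
    where open ≡-Reasoning

  ⋆-dilate-digits : ∀ q → (∀ i → k ≤ i → q i ≡ 0) →
                    ∀ u n → (q ⋆ dilate k u) n ≡ q (n % k) * u (n / k)
  ⋆-dilate-digits q deg<k u n = <-rec Digits step n u
    where
    Digits : ℕ → Set
    Digits n = ∀ u → (q ⋆ dilate k u) n ≡ q (n % k) * u (n / k)

    step : ∀ n → (∀ {m} → m < n → Digits m) → Digits n
    step n ih u with <⊎≡+ k n
    ... | inj₁ n<k = begin
      (q ⋆ dilate k u) n      ≡⟨ ⋆-comm q (dilate k u) n ⟩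
      (dilate k u ⋆ q) n      ≡⟨ ⋆-dilateˡ u q n ⟩
      u 0 * q n + shift k _ n ≡⟨ cong (u 0 * q n +_) (shift-< k _ n<k) ⟩
      u 0 * q n + 0           ≡⟨ trans (+-identityʳ _) (*-comm (u 0) (q n)) ⟩
      q n * u 0               ≡⟨ cong₂ (λ r d → q r * u d) (m<n⇒m%n≡m n<k) (m<n⇒m/n≡0 n<k) ⟨
      q (n % k) * u (n / k)   ∎
      where open ≡-Reasoning
    ... | inj₂ (j , refl) = begin
      (q ⋆ dilate k u) (k + j)
        ≡⟨ ⋆-comm q (dilate k u) (k + j) ⟩
      (dilate k u ⋆ q) (k + j)
        ≡⟨ ⋆-dilateˡ u q (k + j) ⟩
      u 0 * q (k + j) + shift k (dilate k (tail u) ⋆ q) (k + j)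
        ≡⟨ cong₂ _+_ (trans (cong (u 0 *_) (deg<k (k + j) (m≤m+n k j))) (*-zeroʳ (u 0))) (shift-+ k _ j) ⟩
      (dilate k (tail u) ⋆ q) j
        ≡⟨ ⋆-comm _ q j ⟩
      (q ⋆ dilate k (tail u)) j
        ≡⟨ ih (j<k+j j) (tail u) ⟩
      q (j % k) * u (suc (j / k))
        ≡⟨ cong₂ (λ r d → q r * u d) ([k+j]%k≡j%k j) ([k+j]/k≡1+j/k j) ⟨
      q ((k + j) % k) * u ((k + j) / k)
        ∎
      where open ≡-Reasoning

  dilate-⋆ : ∀ a b → dilate k a ⋆ dilate k b ≗ dilate k (a ⋆ b)
  dilate-⋆ a b n = <-rec Multiplicative step n a b
    where
    Multiplicative : ℕ → Set
    Multiplicative n = ∀ a b → (dilate k a ⋆ dilate k b) n ≡ dilate k (a ⋆ b) n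

    step : ∀ n → (∀ {m} → m < n → Multiplicative m) → Multiplicative n
    step n ih a b with <⊎≡+ k n
    ... | inj₁ n<k = begin
      (dilate k a ⋆ dilate k b) n
        ≡⟨ ⋆-dilateˡ a (dilate k b) n ⟩
      a 0 * dilate k b n + shift k _ n
        ≡⟨ cong₂ _+_ (cong (a 0 *_) (dilate-< b n<k)) (shift-< k _ n<k) ⟩
      a 0 * (b 0 * oneCoeff n) + 0
        ≡⟨ cong (_+ 0) (*-assoc (a 0) (b 0) (oneCoeff n)) ⟨
      a 0 * b 0 * oneCoeff n + 0
        ≡⟨ cong (a 0 * b 0 * oneCoeff n +_) (shift-< k (dilate k (tail (a ⋆ b))) n<k) ⟨
      (a ⋆ b) 0 * oneCoeff n + shift k (dilate k (tail (a ⋆ b))) n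
        ≡⟨ dilate-unfold (a ⋆ b) n ⟨
      dilate k (a ⋆ b) n
        ∎
      where open ≡-Reasoning
    ... | inj₂ (j , refl) = begin
      (dilate k a ⋆ dilate k b) (k + j)
        ≡⟨ ⋆-dilateˡ a (dilate k b) (k + j) ⟩
      a 0 * dilate k b (k + j) + shift k (dilate k (tail a) ⋆ dilate k b) (k + j)
        ≡⟨ cong₂ _+_ (cong (a 0 *_) (dilate-+ b j)) (shift-+ k _ j) ⟩
      a 0 * dilate k (tail b) j + (dilate k (tail a) ⋆ dilate k b) j
        ≡⟨ cong₂ _+_ (dilate-·ₛ (a 0) (tail b) j) (sym (ih (j<k+j j) (tail a) b)) ⟨
      dilate k (a 0 ·ₛ tail b) j + dilate k (tail a ⋆ b) j
        ≡⟨ dilate-+ₛ (a 0 ·ₛ tail b) (tail a ⋆ b) j ⟨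
      dilate k (tail (a ⋆ b)) j
        ≡⟨ dilate-+ (a ⋆ b) j ⟨
      dilate k (a ⋆ b) (k + j)
        ∎
      where open ≡-Reasoning

  dilate-oneCoeff : dilate k oneCoeff ≗ oneCoeff
  dilate-oneCoeff n with <⊎≡+ k n
  ... | inj₁ n<k        = trans (dilate-< oneCoeff n<k) (*-identityˡ (oneCoeff n))
  ... | inj₂ (j , refl) = trans (dilate-+ oneCoeff j) (trans (dilate-0 j) (sym (oneCoeff[k+j]≡0 j)))
    where
    dilate-0 : dilate k (λ _ → 0) ≗ λ _ → 0
    dilate-0 j with j % k ≡ᵇ 0
    ... | true  = refl
    ... | false = refl

dilate-congᵏ : ∀ {k k′} .{{_ : NonZero k}} .{{_ : NonZero k′}} → k ≡ k′ → ∀ a → dilate k a ≗ dilate k′ a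
dilate-congᵏ refl a n = refl

dilate-dilate : ∀ k m .{{_ : NonZero k}} .{{_ : NonZero m}} a →
                dilate k (dilate m a) ≗ dilate (m * k) {{m*n≢0 m k}} a
dilate-dilate k m a n with n % k ≟ 0
... | no n%k≢0 = trans (dilate-∤ k (dilate m a) n n%k≢0) (sym (dilate-∤ (m * k) a n n%mk≢0))
  where
  instance _ = m*n≢0 m k
  n%mk≢0 : n % (m * k) ≢ 0
  n%mk≢0 e = n%k≢0 (trans (sym (m∣n⇒o%n%m≡o%m k (m * k) n (n∣m*n m)))
                  (trans (cong (_% k) e) (0%n≡0 k)))
... | yes n%k≡0 = trans (dilate-∣ k (dilate m a) n n%k≡0) inner
  where
  instance _ = m*n≢0 m k
  n/k*k≡n : n / k * k ≡ n
  n/k*k≡n = sym (trans (m≡m%n+[m/n]*n n k) (cong (_+ n / k * k) n%k≡0))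
  n/k%m*k≡n%mk : n / k % m * k ≡ n % (m * k)
  n/k%m*k≡n%mk = trans (m%n*o≡m*o%[n*o] (n / k) m k) (cong (_% (m * k)) n/k*k≡n)
  inner : dilate m a (n / k) ≡ dilate (m * k) a n
  inner with n / k % m ≟ 0
  ... | yes e = trans (dilate-∣ m a (n / k) e)
                (trans (cong a (trans (m/n/o≡m/[n*o] n k m {{_}} {{_}} {{m*n≢0 k m}})
                                      (/-congʳ {{m*n≢0 k m}} (*-comm k m))))
                (sym (dilate-∣ (m * k) a n (trans (sym n/k%m*k≡n%mk) (cong (_* k) e)))))
  ... | no ne = trans (dilate-∤ m a (n / k) ne)
                (sym (dilate-∤ (m * k) a n (λ e → ne (m*n≡0⇒m≡0 (n / k % m) k (trans n/k%m*k≡n%mk e)))))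

dilate-comm : ∀ k m .{{_ : NonZero k}} .{{_ : NonZero m}} a → dilate k (dilate m a) ≗ dilate m (dilate k a)
dilate-comm k m a n = begin
  dilate k (dilate m a) n            ≡⟨ dilate-dilate k m a n ⟩
  dilate (m * k) {{m*n≢0 m k}} a n   ≡⟨ dilate-congᵏ {{m*n≢0 m k}} {{m*n≢0 k m}} (*-comm m k) a n ⟩
  dilate (k * m) {{m*n≢0 k m}} a n   ≡⟨ dilate-dilate m k a n ⟨
  dilate m (dilate k a) n            ∎
  where open ≡-Reasoning

-- Congruence modulo p and Mahler equations

module Congruence (p : ℕ) .{{_ : NonZero p}} where

  infix 4 _≋_ _≈_

  _≋_ : ℕ → ℕ → Set
  x ≋ y = x % p ≡ y % p

  _≈_ : Series → Series → Set
  a ≈ b = ∀ n → a n ≋ b n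

  ≗⇒≈ : ∀ {a b} → a ≗ b → a ≈ b
  ≗⇒≈ a≗b n = cong (_% p) (a≗b n)

  ≈-refl : ∀ {a} → a ≈ a
  ≈-refl _ = refl

  ≈-trans : ∀ {a b c} → a ≈ b → b ≈ c → a ≈ c
  ≈-trans a≈b b≈c n = trans (a≈b n) (b≈c n)

  ≈-setoid : Setoid 0ℓ 0ℓ
  ≈-setoid = record
    { Carrier       = Series
    ; _≈_           = _≈_
    ; isEquivalence = record { refl = ≈-refl ; sym = λ a≈b n → sym (a≈b n) ; trans = ≈-trans }
    }

  module ≈-Reasoning = SetoidReasoning ≈-setoid

  %-≋ : ∀ x → x % p ≋ x
  %-≋ x = m%n%n≡m%n x p

  +-≋ : ∀ {x x′ y y′} → x ≋ x′ → y ≋ y′ → x + y ≋ x′ + y′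
  +-≋ {x} {x′} {y} {y′} x≋x′ y≋y′ = begin
    (x + y) % p                 ≡⟨ %-distribˡ-+ x y p ⟩
    (x % p + y % p) % p         ≡⟨ cong₂ (λ s t → (s + t) % p) x≋x′ y≋y′ ⟩
    (x′ % p + y′ % p) % p       ≡⟨ %-distribˡ-+ x′ y′ p ⟨
    (x′ + y′) % p               ∎
    where open ≡-Reasoning

  *-≋ : ∀ {x x′ y y′} → x ≋ x′ → y ≋ y′ → x * y ≋ x′ * y′
  *-≋ {x} {x′} {y} {y′} x≋x′ y≋y′ = begin
    (x * y) % p                 ≡⟨ %-distribˡ-* x y p ⟩
    (x % p * (y % p)) % p       ≡⟨ cong₂ (λ s t → (s * t) % p) x≋x′ y≋y′ ⟩
    (x′ % p * (y′ % p)) % p     ≡⟨ %-distribˡ-* x′ y′ p ⟨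
    (x′ * y′) % p               ∎
    where open ≡-Reasoning

  ⋆-≋ : ∀ n {a a′ b b′} → (∀ i → i ≤ n → a i ≋ a′ i) → (∀ i → i ≤ n → b i ≋ b′ i) →
        (a ⋆ b) n ≋ (a′ ⋆ b′) n
  ⋆-≋ zero    a≋a′ b≋b′ = *-≋ (a≋a′ 0 z≤n) (b≋b′ 0 z≤n)
  ⋆-≋ (suc n) a≋a′ b≋b′ = +-≋ (*-≋ (a≋a′ 0 z≤n) (b≋b′ (suc n) ≤-refl))
    (⋆-≋ n (λ i i≤n → a≋a′ (suc i) (s≤s i≤n)) (λ i i≤n → b≋b′ i (m≤n⇒m≤1+n i≤n)))

  ⋆-≈ : ∀ {a a′ b b′} → a ≈ a′ → b ≈ b′ → a ⋆ b ≈ a′ ⋆ b′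
  ⋆-≈ a≈a′ b≈b′ n = ⋆-≋ n (λ i _ → a≈a′ i) (λ i _ → b≈b′ i)

  dilate-≈ : ∀ k .{{_ : NonZero k}} {a b} → a ≈ b → dilate k a ≈ dilate k b
  dilate-≈ k a≈b n with n % k ≡ᵇ 0
  ... | true  = a≈b (n / k)
  ... | false = refl

  ≈⋆dilate-from-digits : ∀ k .{{_ : NonZero k}} q → (∀ i → k ≤ i → q i ≡ 0) → ∀ a b →
                         (∀ n → a n ≡ (b (n / k) * q (n % k)) % p) → a ≈ q ⋆ dilate k b
  ≈⋆dilate-from-digits k q deg<k a b a-digits n = begin
    a n % p                                ≡⟨ cong (_% p) (a-digits n) ⟩
    ((b (n / k) * q (n % k)) % p) % p      ≡⟨ %-≋ _ ⟩
    (b (n / k) * q (n % k)) % p            ≡⟨ cong (_% p) (*-comm (b (n / k)) _) ⟩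
    (q (n % k) * b (n / k)) % p            ≡⟨ cong (_% p) (⋆-dilate-digits k q deg<k b n) ⟨
    (q ⋆ dilate k b) n % p                 ∎
    where open ≡-Reasoning

  -- Coefficient n of q ⋆ dilate k a involves only the a i with i ≤ n / k, which is < n when n > 0.
  mahlerEquation-unique : ∀ k .{{_ : NonZero k}} → 1 < k → ∀ q {a b} →
                          a ≈ q ⋆ dilate k a → b ≈ q ⋆ dilate k b → a 0 ≋ b 0 → a ≈ b
  mahlerEquation-unique k 1<k q {a} {b} a-eq b-eq a₀≋b₀ = <-rec (λ n → a n ≋ b n) step
    where
    step : ∀ n → (∀ {m} → m < n → a m ≋ b m) → a n ≋ b n
    step zero    _  = a₀≋b₀
    step (suc n) ih =
      trans (a-eq (suc n)) (trans (⋆-≋ (suc n) {q} {q} (λ _ _ → refl) agree) (sym (b-eq (suc n))))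
      where
      i/k<1+n : ∀ i → i ≤ suc n → i / k < suc n
      i/k<1+n zero    _       = subst (_< suc n) (sym (0/n≡0 k)) z<s
      i/k<1+n (suc i) i≤1+n   = <-≤-trans (m/n<m (suc i) k 1<k) i≤1+n
      agree : ∀ i → i ≤ suc n → dilate k a i ≋ dilate k b i
      agree i i≤1+n with i % k ≡ᵇ 0
      ... | true  = ih (i/k<1+n i i≤1+n)
      ... | false = refl

-- Binomial series and Frobenius

binomial : ℕ → Series
binomial a = a C_

binomial-0 : binomial 0 ≗ oneCoeff
binomial-0 zero    = refl
binomial-0 (suc i) = k>n⇒nCk≡0 {n = 0} {k = suc i} z<s

tail-binomial-1 : tail (binomial 1) ≗ oneCoeff
tail-binomial-1 zero    = refl
tail-binomial-1 (suc i) = k>n⇒nCk≡0 {n = 1} {k = suc (suc i)} (s≤s (s≤s z≤n))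

binomial-suc : ∀ a → binomial (suc a) ≗ binomial 1 ⋆ binomial a
binomial-suc a zero    = refl
binomial-suc a (suc n) = begin
  suc a C suc n                                 ≡⟨ nCk+nC[k+1]≡[n+1]C[k+1] a n ⟨
  a C n + a C suc n                             ≡⟨ +-comm (a C n) _ ⟩
  a C suc n + a C n                             ≡⟨ cong₂ _+_ (+-identityʳ _) tail-term ⟨
  a C suc n + 0 + (tail (binomial 1) ⋆ binomial a) n ∎
  where
  open ≡-Reasoning
  tail-term : (tail (binomial 1) ⋆ binomial a) n ≡ a C n
  tail-term = trans (⋆-congʳ (binomial a) tail-binomial-1 n) (⋆-identityˡ (binomial a) n)

binomial-+ : ∀ a b → binomial a ⋆ binomial b ≗ binomial (a + b)
binomial-+ zero    b n = trans (⋆-congʳ (binomial b) binomial-0 n) (⋆-identityˡ (binomial b) n)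
binomial-+ (suc a) b n = begin
  (binomial (suc a) ⋆ binomial b) n          ≡⟨ ⋆-congʳ (binomial b) (binomial-suc a) n ⟩
  (binomial 1 ⋆ binomial a ⋆ binomial b) n   ≡⟨ ⋆-assoc (binomial 1) (binomial a) (binomial b) n ⟩
  (binomial 1 ⋆ (binomial a ⋆ binomial b)) n ≡⟨ ⋆-congˡ (binomial 1) (binomial-+ a b) n ⟩
  (binomial 1 ⋆ binomial (a + b)) n          ≡⟨ binomial-suc (a + b) n ⟨
  binomial (suc a + b) n                     ∎
  where open ≡-Reasoning

dilate-binomial-1 : ∀ k .{{_ : NonZero k}} → dilate k (binomial 1) ≗ oneCoeff +ₛ shift k oneCoeff
dilate-binomial-1 k n = trans (dilate-unfold k (binomial 1) n)
  (cong₂ _+_ (*-identityˡ (oneCoeff n))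
             (shift-cong k (λ i → trans (dilate-cong k tail-binomial-1 i) (dilate-oneCoeff k i)) n))

module _ (p : ℕ) .{{_ : NonZero p}} (p-prime : Prime p) where

  open Congruence p

  private
    1<p : 1 < p
    1<p = nonTrivial⇒n>1 p {{prime⇒nonTrivial p-prime}}

  ¬p∣m! : ∀ m → m < p → ¬ p ∣ m !
  ¬p∣m! zero    _   p∣1 = <⇒≢ 1<p (sym (∣1⇒≡1 p∣1))
  ¬p∣m! (suc m) m<p p∣m! with euclidsLemma (suc m) (m !) p-prime p∣m!
  ... | inj₁ p∣1+m = <⇒≱ m<p (∣⇒≤ p∣1+m)
  ... | inj₂ p∣m!′ = ¬p∣m! m (<-trans (n<1+n m) m<p) p∣m!′

  p∣pCn : ∀ n → 0 < n → n < p → p ∣ p C n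
  p∣pCn n 0<n n<p with euclidsLemma (p C n) (n ! * (p ∸ n) !) p-prime p∣pCn*n!*[p∸n]!
    where
    instance _ = n !* (p ∸ n) !≢0
    pCn*n!*[p∸n]!≡p! : (p C n) * (n ! * (p ∸ n) !) ≡ p !
    pCn*n!*[p∸n]!≡p! = trans (cong (_* (n ! * (p ∸ n) !)) (nCk≡n!/k![n-k]! (<⇒≤ n<p)))
                             (m/n*n≡m (k![n∸k]!∣n! (<⇒≤ n<p)))
    p∣p! : p ∣ p !
    p∣p! = subst (λ m → m ∣ m !) (suc-pred p) (m∣m*n ((pred p) !))
    p∣pCn*n!*[p∸n]! : p ∣ (p C n) * (n ! * (p ∸ n) !)
    p∣pCn*n!*[p∸n]! = subst (p ∣_) (sym pCn*n!*[p∸n]!≡p!) p∣p!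
  ... | inj₁ p∣pCn = p∣pCn
  ... | inj₂ p∣n!*[p∸n]! with euclidsLemma (n !) ((p ∸ n) !) p-prime p∣n!*[p∸n]!
  ... | inj₁ p∣n!      = ⊥-elim (¬p∣m! n n<p p∣n!)
  ... | inj₂ p∣[p∸n]!  = ⊥-elim (¬p∣m! (p ∸ n) (∸-monoʳ-< 0<n (<⇒≤ n<p)) p∣[p∸n]!)

  binomial-frobenius : binomial p ≈ dilate p (binomial 1)
  binomial-frobenius n = trans (coefficient n) (cong (_% p) (sym (dilate-binomial-1 p n)))
    where
    coefficient-< : ∀ n → n < p → p C n ≋ oneCoeff n + shift p oneCoeff n
    coefficient-< zero    0<p = cong (λ m → (1 + m) % p) (sym (shift-< p oneCoeff 0<p))
    coefficient-< (suc m) n<p = begin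
      (p C suc m) % p              ≡⟨ n∣m⇒m%n≡0 _ _ (p∣pCn (suc m) z<s n<p) ⟩
      0                            ≡⟨ 0%n≡0 p ⟨
      0 % p                        ≡⟨ cong (_% p) (shift-< p oneCoeff n<p) ⟨
      shift p oneCoeff (suc m) % p ∎
      where open ≡-Reasoning

    coefficient : ∀ n → p C n ≋ oneCoeff n + shift p oneCoeff n
    coefficient n with <⊎≡+ p n
    ... | inj₁ n<p = coefficient-< n n<p
    ... | inj₂ (j , refl) = cong (_% p) (begin
      p C (p + j)                                   ≡⟨ pC[p+j]≡oneCoeff j ⟩
      oneCoeff j                                    ≡⟨ shift-+ p oneCoeff j ⟨
      shift p oneCoeff (p + j)                      ≡⟨ cong (_+ shift p oneCoeff (p + j)) oneCoeff[p+j]≡0 ⟨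
      oneCoeff (p + j) + shift p oneCoeff (p + j)   ∎)
      where
      open ≡-Reasoning
      oneCoeff[p+j]≡0 : oneCoeff (p + j) ≡ 0
      oneCoeff[p+j]≡0 = cong (λ m → oneCoeff (m + j)) (sym (suc-pred p))
      pC[p+j]≡oneCoeff : ∀ j → p C (p + j) ≡ oneCoeff j
      pC[p+j]≡oneCoeff zero    = trans (cong (p C_) (+-identityʳ p)) (nCn≡1 p)
      pC[p+j]≡oneCoeff (suc j) = k>n⇒nCk≡0 (m<m+n p z<s)

-- Uniform morphisms and their fixed points

nth-applyUpTo : ∀ (g : ℕ → ℕ) m j → j < m → nth (applyUpTo g m) j ≡ g j
nth-applyUpTo g (suc m) zero    _         = refl
nth-applyUpTo g (suc m) (suc j) (s≤s j<m) = nth-applyUpTo (g ∘ suc) m j j<m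

nth-word : ∀ m g j → j < m → nth (word m g) j ≡ g j
nth-word m g j j<m = trans (cong (λ l → nth l j) (map-applyUpTo id g m)) (nth-applyUpTo g m j j<m)

length-word : ∀ m g → length (word m g) ≡ m
length-word m g = trans (length-map g (upTo m)) (length-applyUpTo id m)

nth-++ˡ : ∀ (u v : List ℕ) i → i < length u → nth (u ++ v) i ≡ nth u i
nth-++ˡ (x ∷ u) v zero    _         = refl
nth-++ˡ (x ∷ u) v (suc i) (s≤s i<u) = nth-++ˡ u v i i<u

nth-++ʳ : ∀ (u v : List ℕ) j → nth (u ++ v) (length u + j) ≡ nth v j
nth-++ʳ []      v j = refl
nth-++ʳ (x ∷ u) v j = nth-++ʳ u v j

module UniformMorphism (σ : ℕ → List ℕ) (k : ℕ) .{{_ : NonZero k}} (length-σ : ∀ x → length (σ x) ≡ k) where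

  length-ext : ∀ w → length (ext σ w) ≡ length w * k
  length-ext []      = refl
  length-ext (x ∷ w) = trans (length-++ (σ x)) (cong₂ _+_ (length-σ x) (length-ext w))

  nth-ext : ∀ w q r → q < length w → r < k → nth (ext σ w) (q * k + r) ≡ nth (σ (nth w q)) r
  nth-ext (x ∷ w) zero    r _         r<k = nth-++ˡ (σ x) (ext σ w) r (subst (r <_) (sym (length-σ x)) r<k)
  nth-ext (x ∷ w) (suc q) r (s≤s q<w) r<k = begin
    nth (σ x ++ ext σ w) (k + q * k + r)                ≡⟨ cong (nth (σ x ++ ext σ w)) index ⟩
    nth (σ x ++ ext σ w) (length (σ x) + (q * k + r))   ≡⟨ nth-++ʳ (σ x) (ext σ w) (q * k + r) ⟩
    nth (ext σ w) (q * k + r)                           ≡⟨ nth-ext w q r q<w r<k ⟩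
    nth (σ (nth w q)) r                                 ∎
    where
    open ≡-Reasoning
    index : k + q * k + r ≡ length (σ x) + (q * k + r)
    index = trans (+-assoc k (q * k) r) (cong (_+ (q * k + r)) (sym (length-σ x)))

  nth-ext-divMod : ∀ w i → i < length w * k → nth (ext σ w) i ≡ nth (σ (nth w (i / k))) (i % k)
  nth-ext-divMod w i i<wk = trans (cong (nth (ext σ w)) (trans (m≡m%n+[m/n]*n i k) (+-comm (i % k) _)))
                                  (nth-ext w (i / k) (i % k) (m<n*o⇒m/o<n i<wk) (m%n<n i k))

module ScalingMorphism (p : ℕ) .{{_ : NonZero p}} (1<p : 1 < p) (f : Series) (f₀≡1 : f 0 ≡ 1) where

  σ : ℕ → List ℕ
  σ n = word p (λ i → (n * f i) % p)

  iterate : ℕ → List ℕ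
  iterate k = iter k (ext σ) (1 ∷ [])

  -- Letter j of the limit word: it is already fixed in iterate (suc j), of length p ^ (suc j) > j.
  fixedPoint : Series
  fixedPoint j = nth (iterate (suc j)) j

  open UniformMorphism σ p (λ _ → length-word p _)
  open Congruence p

  length-iterate : ∀ k → length (iterate k) ≡ p ^ k
  length-iterate zero    = refl
  length-iterate (suc k) =
    trans (length-ext (iterate k)) (trans (cong (_* p) (length-iterate k)) (*-comm (p ^ k) p))

  nth-iterate-suc : ∀ k i → i < p ^ suc k → nth (iterate (suc k)) i ≡ (nth (iterate k) (i / p) * f (i % p)) % p
  nth-iterate-suc k i i<p^[1+k] =
    trans (nth-ext-divMod (iterate k) i (subst (i <_) length≡ i<p^[1+k])) (nth-word p _ (i % p) (m%n<n i p))
    where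
    length≡ : p ^ suc k ≡ length (iterate k) * p
    length≡ = sym (trans (cong (_* p) (length-iterate k)) (*-comm (p ^ k) p))

  n<p^n : ∀ n → n < p ^ n
  n<p^n zero    = z<s
  n<p^n (suc n) = ≤-<-trans (n<p^n n) (^-monoʳ-< p 1<p (n<1+n n))

  n<p^[1+n] : ∀ n → n < p ^ suc n
  n<p^[1+n] n = <-≤-trans (n<p^n n) (^-monoʳ-≤ p (n≤1+n n))

  iterate-prefix : ∀ k i → i < p ^ k → nth (iterate (suc k)) i ≡ nth (iterate k) i
  iterate-prefix zero    zero    _ = begin
    nth (iterate 1) 0                 ≡⟨ nth-iterate-suc 0 0 (n<p^[1+n] 0) ⟩
    (nth (1 ∷ []) (0 / p) * f (0 % p)) % p ≡⟨ cong₂ (λ q r → (nth (1 ∷ []) q * f r) % p) (0/n≡0 p) (0%n≡0 p) ⟩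
    (1 * f 0) % p                     ≡⟨ cong (λ x → (1 * x) % p) f₀≡1 ⟩
    1 % p                             ≡⟨ m<n⇒m%n≡m 1<p ⟩
    1                                 ∎
    where open ≡-Reasoning
  iterate-prefix zero    (suc i) (s≤s ())
  iterate-prefix (suc k) i i<p^[1+k] = begin
    nth (iterate (2 + k)) i
      ≡⟨ nth-iterate-suc (suc k) i (<-≤-trans i<p^[1+k] (^-monoʳ-≤ p (n≤1+n (suc k)))) ⟩
    (nth (iterate (suc k)) (i / p) * f (i % p)) % p
      ≡⟨ cong (λ x → (x * f (i % p)) % p) (iterate-prefix k (i / p) i/p<p^k) ⟩
    (nth (iterate k) (i / p) * f (i % p)) % p
      ≡⟨ nth-iterate-suc k i i<p^[1+k] ⟨
    nth (iterate (suc k)) i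
      ∎
    where
    open ≡-Reasoning
    i/p<p^k : i / p < p ^ k
    i/p<p^k = m<n*o⇒m/o<n (subst (i <_) (*-comm p (p ^ k)) i<p^[1+k])

  iterate-prefix-≤ : ∀ {k m} i → k ≤′ m → i < p ^ k → nth (iterate m) i ≡ nth (iterate k) i
  iterate-prefix-≤ i ≤′-refl                  _     = refl
  iterate-prefix-≤ i (≤′-step {m} k≤′m) i<p^k =
    trans (iterate-prefix m i (<-≤-trans i<p^k (^-monoʳ-≤ p (≤′⇒≤ k≤′m)))) (iterate-prefix-≤ i k≤′m i<p^k)

  fixedPoint-iterate : ∀ k i → i < p ^ k → fixedPoint i ≡ nth (iterate k) i
  fixedPoint-iterate k i i<p^k with ≤-total k (suc i)
  ... | inj₁ k≤1+i = iterate-prefix-≤ i (≤⇒≤′ k≤1+i) i<p^k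
  ... | inj₂ 1+i≤k = sym (iterate-prefix-≤ i (≤⇒≤′ 1+i≤k) (n<p^[1+n] i))

  fixedPoint-digits : ∀ n → fixedPoint n ≡ (fixedPoint (n / p) * f (n % p)) % p
  fixedPoint-digits n = trans (nth-iterate-suc n n (n<p^[1+n] n))
    (cong (λ x → (x * f (n % p)) % p) (sym (fixedPoint-iterate n (n / p) n/p<p^n)))
    where
    n/p<p^n : n / p < p ^ n
    n/p<p^n = ≤-<-trans (m/n≤m n p) (n<p^n n)

  fixedPoint-0 : fixedPoint 0 ≡ 1
  fixedPoint-0 = iterate-prefix 0 0 z<s

  fixedPoint-mahler : (∀ i → p ≤ i → f i ≡ 0) → fixedPoint ≈ f ⋆ dilate p fixedPoint
  fixedPoint-mahler deg<p = ≈⋆dilate-from-digits p f deg<p fixedPoint fixedPoint fixedPoint-digits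

  module Image (K : ℕ) .{{_ : NonZero K}} (g : Series) (deg<K : ∀ i → K ≤ i → g i ≡ 0) where

    ψ : ℕ → List ℕ
    ψ n = word K (λ i → (n * g i) % p)

    image : Series
    image j = nth (ext ψ (iterate (suc j))) j

    image-mahler : image ≈ g ⋆ dilate K fixedPoint
    image-mahler = ≈⋆dilate-from-digits K g deg<K image fixedPoint image-digits
      where
      open ≡-Reasoning
      open UniformMorphism ψ K (λ _ → length-word K _)
        using () renaming (nth-ext-divMod to nth-extψ-divMod)
      n<|iterate|*K : ∀ n → n < length (iterate (suc n)) * K
      n<|iterate|*K n = <-≤-trans (n<p^[1+n] n)
        (subst (λ l → p ^ suc n ≤ l * K) (sym (length-iterate (suc n))) (m≤m*n (p ^ suc n) K))
      image-digits : ∀ n → image n ≡ (fixedPoint (n / K) * g (n % K)) % p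
      image-digits n = begin
        nth (ext ψ (iterate (suc n))) n
          ≡⟨ nth-extψ-divMod (iterate (suc n)) n (n<|iterate|*K n) ⟩
        nth (ψ (nth (iterate (suc n)) (n / K))) (n % K)
          ≡⟨ nth-word K _ (n % K) (m%n<n n K) ⟩
        (nth (iterate (suc n)) (n / K) * g (n % K)) % p
          ≡⟨ cong (λ x → (x * g (n % K)) % p)
                  (fixedPoint-iterate (suc n) (n / K) (≤-<-trans (m/n≤m n K) (n<p^[1+n] n))) ⟨
        (fixedPoint (n / K) * g (n % K)) % p
          ∎

-- The Cantor and Singer series

module CantorSinger (p : ℕ) .{{_ : NonZero p}} (p-prime : Prime p) (p≢2 : p ≢ 2) where

  open Congruence p

  instance
    2p≢0 : NonZero (2 * p)
    2p≢0 = m*n≢0 2 p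

  1<p : 1 < p
  1<p = nonTrivial⇒n>1 p {{prime⇒nonTrivial p-prime}}

  p%2≡1 : p % 2 ≡ 1
  p%2≡1 with p % 2 in p%2≡r | m%n<n p 2
  ... | 0           | _ =
    ⊥-elim ([ (λ ()) , (λ 2≡p → p≢2 (sym 2≡p)) ]′ (prime⇒irreducible p-prime (m%n≡0⇒n∣m p 2 p%2≡r)))
  ... | 1           | _ = refl
  ... | suc (suc _) | s≤s (s≤s ())

  p≡1+p₂*2 : p ≡ 1 + p₂ p * 2
  p≡1+p₂*2 = trans p≡1+[p/2]*2 (cong (λ q → 1 + q * 2) p/2≡p₂)
    where
    p≡1+[p/2]*2 : p ≡ 1 + p / 2 * 2
    p≡1+[p/2]*2 = trans (m≡m%n+[m/n]*n p 2) (cong (_+ p / 2 * 2) p%2≡1)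
    p/2≡p₂ : p / 2 ≡ p₂ p
    p/2≡p₂ = sym (trans (cong (λ m → (m ∸ 1) / 2) p≡1+[p/2]*2) (m*n/n≡m (p / 2) 2))

  p₂+p₂+1≡p : p₂ p + p₂ p + 1 ≡ p
  p₂+p₂+1≡p = trans (+-comm (p₂ p + p₂ p) 1)
    (trans (cong (λ m → 1 + (p₂ p + m)) (sym (+-identityʳ (p₂ p))))
           (trans (cong suc (*-comm 2 (p₂ p))) (sym p≡1+p₂*2)))

  p₂*2<p : p₂ p * 2 < p
  p₂*2<p = subst (p₂ p * 2 <_) (sym p≡1+p₂*2) (n<1+n _)

  -- binomHalf a is definitionally dilate 2 (binomial a).
  R P Q E : Series
  R = binomial (p₂ p)
  P = binomHalf (p₂ p)
  Q = binomHalf (suc (p₂ p))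
  E = binomHalf 1

  R-degree : ∀ i → p ≤ i → R i ≡ 0
  R-degree i p≤i = k>n⇒nCk≡0 (<-≤-trans (≤-<-trans (m≤m*n (p₂ p) 2) p₂*2<p) p≤i)

  P-degree : ∀ i → p ≤ i → P i ≡ 0
  P-degree i p≤i = dilate-degree 2 (λ _ → k>n⇒nCk≡0) i (<-≤-trans p₂*2<p p≤i)

  Q-degree : ∀ i → 2 * p ≤ i → Q i ≡ 0
  Q-degree i 2p≤i = dilate-degree 2 (λ _ → k>n⇒nCk≡0) i (<-≤-trans [1+p₂]*2<2p 2p≤i)
    where
    [1+p₂]*2<2p : suc (p₂ p) * 2 < 2 * p
    [1+p₂]*2<2p = subst₂ _<_ (trans (+-comm p 1) (cong suc p≡1+p₂*2)) (cong (p +_) (sym (+-identityʳ p)))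
                         (+-monoʳ-< p 1<p)

  Q≗E⋆P : Q ≗ E ⋆ P
  Q≗E⋆P n = trans (dilate-cong 2 (binomial-suc (p₂ p)) n) (sym (dilate-⋆ 2 (binomial 1) R n))

  P⋆P⋆E≈dilate-p-E : P ⋆ P ⋆ E ≈ dilate p E
  P⋆P⋆E≈dilate-p-E = begin
    P ⋆ P ⋆ E                         ≈⟨ ≗⇒≈ (⋆-congʳ E (dilate-⋆ 2 R R)) ⟩
    dilate 2 (R ⋆ R) ⋆ E              ≈⟨ ≗⇒≈ (dilate-⋆ 2 (R ⋆ R) (binomial 1)) ⟩
    dilate 2 (R ⋆ R ⋆ binomial 1)     ≈⟨ ≗⇒≈ (dilate-cong 2 R⋆R⋆L≗binomial-p) ⟩
    dilate 2 (binomial p)             ≈⟨ dilate-≈ 2 (binomial-frobenius p p-prime) ⟩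
    dilate 2 (dilate p (binomial 1))  ≈⟨ ≗⇒≈ (dilate-comm 2 p (binomial 1)) ⟩
    dilate p E                        ∎
    where
    open ≈-Reasoning
    R⋆R⋆L≗binomial-p : R ⋆ R ⋆ binomial 1 ≗ binomial p
    R⋆R⋆L≗binomial-p n = trans (⋆-congʳ (binomial 1) (binomial-+ (p₂ p) (p₂ p)) n)
      (trans (binomial-+ (p₂ p + p₂ p) 1 n) (cong (λ m → binomial m n) p₂+p₂+1≡p))

  frobenius-square : ∀ A → E ⋆ ((P ⋆ dilate p A) ⋆ (P ⋆ dilate p A)) ≈ dilate p (E ⋆ (A ⋆ A))
  frobenius-square A = begin
    E ⋆ ((P ⋆ dilate p A) ⋆ (P ⋆ dilate p A))
      ≈⟨ ≗⇒≈ (⋆-congˡ E (⋆-interchange P (dilate p A) P (dilate p A))) ⟩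
    E ⋆ ((P ⋆ P) ⋆ (dilate p A ⋆ dilate p A))
      ≈⟨ ≗⇒≈ (⋆-assoc E (P ⋆ P) _) ⟨
    E ⋆ (P ⋆ P) ⋆ (dilate p A ⋆ dilate p A)
      ≈⟨ ⋆-≈ E⋆P⋆P≈dilate-p-E (≗⇒≈ (dilate-⋆ p A A)) ⟩
    dilate p E ⋆ dilate p (A ⋆ A)
      ≈⟨ ≗⇒≈ (dilate-⋆ p E (A ⋆ A)) ⟩
    dilate p (E ⋆ (A ⋆ A))
      ∎
    where
    open ≈-Reasoning
    E⋆P⋆P≈dilate-p-E : E ⋆ (P ⋆ P) ≈ dilate p E
    E⋆P⋆P≈dilate-p-E = ≈-trans (≗⇒≈ (⋆-comm E (P ⋆ P))) P⋆P⋆E≈dilate-p-E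

  module Cantor    = ScalingMorphism p 1<p P refl
  module PreSinger = ScalingMorphism p 1<p R refl
  module Singer    = PreSinger.Image (2 * p) Q Q-degree

  -- cantor p is definitionally Cantor.fixedPoint, and singer p is Singer.image.
  C U S D : Series
  C = cantor p
  U = PreSinger.fixedPoint
  S = singer p
  D = dilate p C

  C≈P⋆D : C ≈ P ⋆ D
  C≈P⋆D = Cantor.fixedPoint-mahler P-degree

  dilate-2-U≈C : dilate 2 U ≈ C
  dilate-2-U≈C = mahlerEquation-unique p 1<p P U₂-mahler C≈P⋆D
    (cong (_% p) (trans PreSinger.fixedPoint-0 (sym Cantor.fixedPoint-0)))
    where
    open ≈-Reasoning
    U₂-mahler : dilate 2 U ≈ P ⋆ dilate p (dilate 2 U)
    U₂-mahler = begin
      dilate 2 U                 ≈⟨ dilate-≈ 2 (PreSinger.fixedPoint-mahler R-degree) ⟩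
      dilate 2 (R ⋆ dilate p U)  ≈⟨ ≗⇒≈ (dilate-⋆ 2 R (dilate p U)) ⟨
      P ⋆ dilate 2 (dilate p U)  ≈⟨ ≗⇒≈ (⋆-congˡ P (dilate-comm 2 p U)) ⟩
      P ⋆ dilate p (dilate 2 U)  ∎

  S≈E⋆P⋆D : S ≈ E ⋆ P ⋆ D
  S≈E⋆P⋆D = begin
    S                          ≈⟨ Singer.image-mahler ⟩
    Q ⋆ dilate (2 * p) U       ≈⟨ ≗⇒≈ (⋆-congˡ Q (dilate-dilate p 2 U)) ⟨
    Q ⋆ dilate p (dilate 2 U)  ≈⟨ ⋆-≈ (≗⇒≈ Q≗E⋆P) (dilate-≈ p dilate-2-U≈C) ⟩
    E ⋆ P ⋆ D                  ∎
    where open ≈-Reasoning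

  E⋆C⋆C≈1 : E ⋆ (C ⋆ C) ≈ oneCoeff
  E⋆C⋆C≈1 = mahlerEquation-unique p 1<p oneCoeff F-mahler 1-mahler F₀≋1
    where
    open ≈-Reasoning
    F : Series
    F = E ⋆ (C ⋆ C)
    F-mahler : F ≈ oneCoeff ⋆ dilate p F
    F-mahler = begin
      E ⋆ (C ⋆ C)                  ≈⟨ ⋆-≈ {E} ≈-refl (⋆-≈ C≈P⋆D C≈P⋆D) ⟩
      E ⋆ ((P ⋆ D) ⋆ (P ⋆ D))      ≈⟨ frobenius-square C ⟩
      dilate p F                   ≈⟨ ≗⇒≈ (⋆-identityˡ (dilate p F)) ⟨
      oneCoeff ⋆ dilate p F        ∎
    1-mahler : oneCoeff ≈ oneCoeff ⋆ dilate p oneCoeff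
    1-mahler = ≗⇒≈ (λ n → sym (trans (⋆-identityˡ _ n) (dilate-oneCoeff p n)))
    F₀≋1 : F 0 ≋ 1
    F₀≋1 = cong (λ c → (1 * (c * c)) % p) Cantor.fixedPoint-0

  C⋆S≈1 : C ⋆ S ≈ oneCoeff
  C⋆S≈1 = begin
    C ⋆ S                      ≈⟨ ⋆-≈ C≈P⋆D S≈E⋆P⋆D ⟩
    (P ⋆ D) ⋆ (E ⋆ P ⋆ D)      ≈⟨ ≗⇒≈ rearrange ⟩
    E ⋆ ((P ⋆ D) ⋆ (P ⋆ D))    ≈⟨ frobenius-square C ⟩
    dilate p (E ⋆ (C ⋆ C))     ≈⟨ dilate-≈ p E⋆C⋆C≈1 ⟩
    dilate p oneCoeff          ≈⟨ ≗⇒≈ (dilate-oneCoeff p) ⟩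
    oneCoeff                   ∎
    where
    open ≈-Reasoning
    rearrange : (P ⋆ D) ⋆ (E ⋆ P ⋆ D) ≗ E ⋆ ((P ⋆ D) ⋆ (P ⋆ D))
    rearrange n = trans (⋆-congˡ (P ⋆ D) (⋆-assoc E P D) n) (⋆-leftComm (P ⋆ D) E (P ⋆ D) n)

lemma3p11 : (p : ℕ) .{{_ : NonZero p}} → Prime p → p ≢ 2 →
    (n : ℕ) → prodCoeff p n ≡ oneCoeff n
lemma3p11 p p-prime p≢2 n = begin
  prodCoeff p n                ≡⟨ cong (_% p) (⋆≡sum (cantor p) (singer p) n) ⟨
  (cantor p ⋆ singer p) n % p  ≡⟨ C⋆S≈1 n ⟩
  oneCoeff n % p               ≡⟨ m<n⇒m%n≡m (oneCoeff<p n) ⟩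
  oneCoeff n                   ∎
  where
  open ≡-Reasoning
  open CantorSinger p p-prime p≢2
  oneCoeff<p : ∀ n → oneCoeff n < p
  oneCoeff<p zero    = 1<p
  oneCoeff<p (suc _) = <-trans z<s 1<p
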